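{- Let $M$ be a max shuffle on $S_n$ and $w\in S_n$. If $w(1)\ge M(w)(1)$, then $M^{n-1}(w)(1)=1$.
   Context: $[n]=\{1,\dots,n\}$, $[a,b]=\{a,\dots,b\}$; $S_n$ is the group of bijections $[n]\to[n]$. A homing shuffle is a map $F:S_n\to S_n$ such that for every $w\in S_n$, setting $k:=w(1)$: (a) $F(w)(k)=k$, and (b) $F(w)(i)=w(i)$ for all $i>k$. A max shuffle is a homing shuffle $M$ such that for every $w\in S_n$ with $w(1)\neq1$, $M(w)(1)=\max(w([2,k]))$ where $k=w(1)$. $M^m$ denotes the $m$-th iterate. -}

module Defs where

open import Data.Nat using (ℕ; zero; suc)
open import Data.Fin using (Fin; zero; suc; _<_; _≤_; toℕ)
open import Data.Fin.Permutation using (Permutation′; _⟨$⟩ʳ_)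
open import Data.Product using (_×_; ∃)
open import Relation.Binary.PropositionalEquality using (_≡_)
open import Relation.Nullary using (¬_)

-- Convention: S_{n+1} is modelled as Permutation′ (suc n) on Fin (suc n);
-- the 1-indexed value/position j corresponds to the Fin element with toℕ = j - 1.
-- Orders on Fin compare toℕ, hence agree with the 1-indexed order.

S : ℕ → Set
S n = Permutation′ n

iter : {A : Set} → (A → A) → ℕ → A → A
iter f zero    x = x
iter f (suc m) x = f (iter f m x)

IsHomingShuffle : ∀ {n} → (S (suc n) → S (suc n)) → Set
IsHomingShuffle {n} F =
  ∀ (w : S (suc n)) →
    (F w ⟨$⟩ʳ (w ⟨$⟩ʳ zero) ≡ w ⟨$⟩ʳ zero)
    × (∀ (i : Fin (suc n)) → (w ⟨$⟩ʳ zero) < i → F w ⟨$⟩ʳ i ≡ w ⟨$⟩ʳ i)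

-- m is the maximum of w over the 1-indexed positions [2, k], where
-- k = w(1); in 0-indexed terms these are the positions i with
-- 1 ≤ toℕ i ≤ toℕ (w zero).
InRange : ∀ {n} → S (suc n) → Fin (suc n) → Set
InRange w i = (¬ (i ≡ zero)) × (i ≤ (w ⟨$⟩ʳ zero))

IsMaxOver : ∀ {n} → S (suc n) → Fin (suc n) → Set
IsMaxOver {n} w m =
  (∃ λ (i : Fin (suc n)) → InRange w i × (w ⟨$⟩ʳ i ≡ m))
  × (∀ (i : Fin (suc n)) → InRange w i → (w ⟨$⟩ʳ i) ≤ m)

IsMaxShuffle : ∀ {n} → (S (suc n) → S (suc n)) → Set
IsMaxShuffle {n} M =
  IsHomingShuffle M
  × (∀ (w : S (suc n)) → ¬ (w ⟨$⟩ʳ zero ≡ zero) → IsMaxOver w (M w ⟨$⟩ʳ zero))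

module Submission where

-- Call v prefix-stable when it maps the positions [1, v(1)] into the values [1, v(1)].
-- The hypothesis M(w)(1) ≤ w(1) makes w prefix-stable, since every value on [2, w(1)] is
-- at most M(w)(1). For a prefix-stable v with k = v(1) ≠ 1, the maximum of v over [2, k]
-- is a value of [1, k] other than k, so M(v)(1) < k; and M(v) is again prefix-stable,
-- because a homing shuffle sends the positions below k to values that v takes on [2, k].
-- Hence iterating M strictly lowers the first entry until it is 1, within w(1) − 1 ≤ n − 1 steps.

open import Defs
open import Data.Nat using (ℕ; zero; suc; z≤n)
import Data.Nat as ℕ using (_≤_; _<_)
import Data.Nat.Properties as ℕₚ
open import Data.Fin using (Fin; zero; toℕ; _≤_; _<_)
open import Data.Fin.Properties
  using (toℕ-injective; toℕ≤pred[n]; ≤-reflexive; ≤-trans; ≤∧≢⇒<; <-irrefl; _≤?_; _≟_)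
open import Data.Fin.Permutation using (Permutation′; _⟨$⟩ʳ_; _⟨$⟩ˡ_; inverseʳ)
open import Data.Product using (_,_; proj₁; proj₂)
open import Data.Sum using (_⊎_; inj₁; inj₂)
open import Function.Bundles using (Injection)
open import Function.Properties.Inverse using (↔⇒↣)
open import Relation.Binary.PropositionalEquality
  using (_≡_; _≢_; refl; sym; trans; cong; subst)
open import Relation.Nullary using (yes; no)
open import Relation.Nullary.Negation using (contradiction)

iter-suc′ : {A : Set} (f : A → A) (m : ℕ) (x : A) → iter f (suc m) x ≡ iter f m (f x)
iter-suc′ f zero    x = refl
iter-suc′ f (suc m) x = cong f (iter-suc′ f m x)

iter-potential≡0 : {A : Set} (f : A → A) (P : A → Set) (φ : A → ℕ) →
  (∀ {x} → P x → P (f x)) →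
  (∀ {x} → P x → φ (f x) ≡ 0 ⊎ φ (f x) ℕ.< φ x) →
  ∀ m {x} → P x → φ x ℕ.≤ m → φ (iter f m x) ≡ 0
iter-potential≡0 f P φ preserve descend zero    px φx≤0    = ℕₚ.n≤0⇒n≡0 φx≤0
iter-potential≡0 f P φ preserve descend (suc m) {x} px φx≤1+m
  rewrite iter-suc′ f m x = iter-potential≡0 f P φ preserve descend m (preserve px) φfx≤m
  where
  φfx≤m : φ (f x) ℕ.≤ m
  φfx≤m with descend px
  ... | inj₁ φfx≡0  = subst (ℕ._≤ m) (sym φfx≡0) z≤n
  ... | inj₂ φfx<φx = ℕₚ.≤-pred (ℕₚ.<-≤-trans φfx<φx φx≤1+m)

⟨$⟩ʳ-injective : ∀ {n} (π : Permutation′ n) {i j : Fin n} → π ⟨$⟩ʳ i ≡ π ⟨$⟩ʳ j → i ≡ j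
⟨$⟩ʳ-injective π = Injection.injective (↔⇒↣ π)

PrefixStable : ∀ {n} → S (suc n) → Set
PrefixStable v = ∀ i → i ≤ v ⟨$⟩ʳ zero → v ⟨$⟩ʳ i ≤ v ⟨$⟩ʳ zero

prefixStable-if-head≡0 : ∀ {n} {v : S (suc n)} → v ⟨$⟩ʳ zero ≡ zero → PrefixStable v
prefixStable-if-head≡0 {v = v} v₀≡0 i i≤v₀ = ≤-reflexive (cong (v ⟨$⟩ʳ_) i≡0)
  where
  i≡0 : i ≡ zero
  i≡0 = toℕ-injective (ℕₚ.n≤0⇒n≡0 (subst (i ≤_) v₀≡0 i≤v₀))

module HomingShuffle {n} {F : S (suc n) → S (suc n)} (homing : IsHomingShuffle F) where

  fixes-head : ∀ w → F w ⟨$⟩ʳ (w ⟨$⟩ʳ zero) ≡ w ⟨$⟩ʳ zero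
  fixes-head w = proj₁ (homing w)

  fixes-tail : ∀ w i → w ⟨$⟩ʳ zero < i → F w ⟨$⟩ʳ i ≡ w ⟨$⟩ʳ i
  fixes-tail w = proj₂ (homing w)

  head≡0⇒head≡0 : ∀ {w} → w ⟨$⟩ʳ zero ≡ zero → F w ⟨$⟩ʳ zero ≡ zero
  head≡0⇒head≡0 {w} w₀≡0 = subst (λ k → F w ⟨$⟩ʳ k ≡ k) w₀≡0 (fixes-head w)

  preimage-inRange : ∀ w i → i < w ⟨$⟩ʳ zero → InRange w (w ⟨$⟩ˡ (F w ⟨$⟩ʳ i))
  preimage-inRange w i i<k = j≢0 , j≤k
    where
    k = w ⟨$⟩ʳ zero
    j = w ⟨$⟩ˡ (F w ⟨$⟩ʳ i)

    w[j]≡F[i] : w ⟨$⟩ʳ j ≡ F w ⟨$⟩ʳ i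
    w[j]≡F[i] = inverseʳ w

    j≢0 : j ≢ zero
    j≢0 j≡0 = <-irrefl i≡k i<k
      where
      i≡k : i ≡ k
      i≡k = ⟨$⟩ʳ-injective (F w)
        (trans (sym w[j]≡F[i]) (trans (cong (w ⟨$⟩ʳ_) j≡0) (sym (fixes-head w))))

    j≤k : j ≤ k
    j≤k with j ≤? k
    ... | yes j≤k = j≤k
    ... | no  j≰k = contradiction (ℕₚ.<-trans k<j (subst (_< k) (sym j≡i) i<k)) (ℕₚ.<-irrefl refl)
      where
      k<j = ℕₚ.≰⇒> j≰k
      j≡i : j ≡ i
      j≡i = ⟨$⟩ʳ-injective (F w) (trans (fixes-tail w j k<j) w[j]≡F[i])

module MaxShuffle {n} {M : S (suc n) → S (suc n)} (isMax : IsMaxShuffle M) where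

  open HomingShuffle {F = M} (proj₁ isMax)

  head-isMax : ∀ v → v ⟨$⟩ʳ zero ≢ zero → IsMaxOver v (M v ⟨$⟩ʳ zero)
  head-isMax = proj₂ isMax

  prefixStable-if-head≤ : ∀ {w} → M w ⟨$⟩ʳ zero ≤ w ⟨$⟩ʳ zero → PrefixStable w
  prefixStable-if-head≤ {w} Mw₀≤w₀ i i≤w₀ with w ⟨$⟩ʳ zero ≟ zero | i ≟ zero
  ... | yes w₀≡0 | _        = prefixStable-if-head≡0 {v = w} w₀≡0 i i≤w₀
  ... | no  _    | yes i≡0  = ≤-reflexive (cong (w ⟨$⟩ʳ_) i≡0)
  ... | no  w₀≢0 | no  i≢0  = ≤-trans (proj₂ (head-isMax w w₀≢0) i (i≢0 , i≤w₀)) Mw₀≤w₀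

  head-decreases : ∀ {v} → PrefixStable v → v ⟨$⟩ʳ zero ≢ zero → M v ⟨$⟩ʳ zero < v ⟨$⟩ʳ zero
  head-decreases {v} stable v₀≢0 with head-isMax v v₀≢0
  ... | (i , (i≢0 , i≤v₀) , v[i]≡m) , _ =
    ≤∧≢⇒< (subst (_≤ v ⟨$⟩ʳ zero) v[i]≡m (stable i i≤v₀))
          (λ m≡v₀ → i≢0 (⟨$⟩ʳ-injective v (trans v[i]≡m m≡v₀)))

  prefixStable-step : ∀ {v} → PrefixStable v → PrefixStable (M v)
  prefixStable-step {v} stable with v ⟨$⟩ʳ zero ≟ zero
  ... | yes v₀≡0 = prefixStable-if-head≡0 {v = M v} (head≡0⇒head≡0 v₀≡0)
  ... | no  v₀≢0 = λ i i≤m →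
    subst (_≤ M v ⟨$⟩ʳ zero) (inverseʳ v)
      (proj₂ (head-isMax v v₀≢0) _
        (preimage-inRange v i (ℕₚ.≤-<-trans i≤m (head-decreases stable v₀≢0))))

  head-descends : ∀ {v} → PrefixStable v →
    toℕ (M v ⟨$⟩ʳ zero) ≡ 0 ⊎ M v ⟨$⟩ʳ zero < v ⟨$⟩ʳ zero
  head-descends {v} stable with v ⟨$⟩ʳ zero ≟ zero
  ... | yes v₀≡0 = inj₁ (cong toℕ (head≡0⇒head≡0 v₀≡0))
  ... | no  v₀≢0 = inj₂ (head-decreases stable v₀≢0)

corollary3 : ∀ (n : ℕ) (M : S (suc n) → S (suc n)) → IsMaxShuffle M →
    ∀ (w : S (suc n)) → (M w ⟨$⟩ʳ zero) ≤ (w ⟨$⟩ʳ zero) →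
    iter M n w ⟨$⟩ʳ zero ≡ zero
corollary3 n M isMax w Mw₀≤w₀ =
  toℕ-injective
    (iter-potential≡0 M PrefixStable (λ v → toℕ (v ⟨$⟩ʳ zero))
      prefixStable-step head-descends
      n (prefixStable-if-head≤ Mw₀≤w₀) (toℕ≤pred[n] (w ⟨$⟩ʳ zero)))
  where open MaxShuffle {M = M} isMax
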